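{- Let ${\cal P}$ be a ${\rm DLP^{<}}$ program consisting of a single object $o=(oid(o),\Sigma(o))$. Then a set $M$ of ground literals is a ${\rm DLP^{<}}$-answer set of ${\cal P}$ if and only if $M$ is a consistent answer set of the disjunctive logic program $\Sigma(o)$ in the sense of Gelfond and Lifschitz.
   Context: ${\rm DLP^{<}}$ setting. Literals are atoms $p(\bar t)$ or their strong negations $\neg p(\bar t)$ over a function-free language; $\neg.L$ denotes the complement of $L$. A rule $r$ has the form $a_1\vee\dots\vee a_n \leftarrow b_1,\dots,b_k,\ \mathtt{not}\ b_{k+1},\dots,\mathtt{not}\ b_m$ with $n\ge1$ and literals $a_i,b_j$. For a single-object program the strict/defeasible marks play no role. We write $Head(r)$, $Body^+(r)=\{b_1..b_k\}$ and $Body^-(r)=\{b_{k+1}..b_m\}$. An object is $(oid(o),\Sigma(o))$ with $\Sigma(o)$ a finite set of rules; a program is a set of objects partially ordered by a strict order $<$. $ground({\cal P})$ is the multiset of ground instances of its rules, over the constants of ${\cal P}$, each tagged with its object $obj\_of(r)$. An interpretation is a consistent set of ground literals. The body of $r$ is true in $I$ iff $Body^+(r)\subseteq I$ and $Body^-(r)\cap I=\emptyset$. The rule $r$ is satisfied iff $Head(r)\cap I\ne\emptyset$ or its body is not true. $r_1$ threatens $r_2$ on $L$ iff $\neg.L\in Head(r_1)$, $L\in Head(r_2)$, $obj\_of(r_1)<obj\_of(r_2)$, and $r_2$ is defeasible. It overrides $r_2$ on $L$ in $I$ iff in addition $\neg.L\in I$ and the body of $r_2$ is true in $I$. A defeasible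 rule is overridden iff every head literal is overridden by some rule. $I$ is a model iff every ground rule is satisfied or overridden. $G_I({\cal P})$ is obtained from $ground({\cal P})$ by removing overridden rules, removing rules with $Body^-(r)\cap I\ne\emptyset$, and deleting the remaining $\mathtt{not}$-parts. $pos(\cdot)$ treats $\neg p$ as a new predicate. A model $M$ is a ${\rm DLP^{<}}$-answer set iff it is a minimal model of $pos(G_M({\cal P}))$. Gelfond–Lifschitz answer sets. Let $\Pi$ be a set of such rules (ground instances understood) and let $Lit$ be the set of all ground literals. For a $\mathtt{not}$-free program $\Pi$, an answer set is a minimal set $S\subseteq Lit$ such that (i) for every rule, if all body literals are in $S$ then some head literal is in $S$, and (ii) if $S$ contains a complementary pair then $S=Lit$. For a general program $\Pi$ and $S\subseteq Lit$, the reduct $\Pi^S$ is obtained by deleting every rule having some $\mathtt{not}\ L$ in its body with $L\in S$, and deleting all $\mathtt{not}$-literals from the remaining rules. $S$ is an answer set of $\Pi$ iff $S$ is an answer set of $\Pi^S$. It is consistent iff it contains no complementary pair. -}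

module Defs where

open import Data.Nat using (ℕ; _≤_)
open import Data.Bool using (Bool; true; false)
open import Data.List using (List; []; _∷_; length)
open import Data.List.Membership.Propositional using (_∈_)
open import Data.Product using (Σ; ∃; _×_; _,_)
open import Data.Sum using (_⊎_)
open import Relation.Nullary using (¬_)
open import Relation.Binary.PropositionalEquality using (_≡_)
open import Relation.Binary.Structures using (IsStrictPartialOrder)

data Term (Cn : Set) : Set where
  var : ℕ → Term Cn
  con : Cn → Term Cn

record Atom (Pr T : Set) : Set where
  constructor atom
  field
    pred : Pr
    args : List T
open Atom public

-- a literal over atoms of type A: p(t) or its strong negation ¬p(t)
data Literal (A : Set) : Set where
  +ₗ : A → Literal A
  -ₗ : A → Literal A

compl : {A : Set} → Literal A → Literal A
compl (+ₗ a) = -ₗ a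
compl (-ₗ a) = +ₗ a

mapLit : {A B : Set} → (A → B) → Literal A → Literal B
mapLit f (+ₗ a) = +ₗ (f a)
mapLit f (-ₗ a) = -ₗ (f a)

-- a1 ∨ ... ∨ an ← b1..bk, not b(k+1) .. not bm,   n ≥ 1,
-- with the strict/defeasible mark (defeasible ≡ true means defeasible)
record Rule (L : Set) : Set where
  constructor mkRule
  field
    head       : List L
    head-ne    : 1 ≤ length head
    bodyPos    : List L
    bodyNeg    : List L
    defeasible : Bool
open Rule public

NLit : Set → Set → Set
NLit Pr Cn = Literal (Atom Pr (Term Cn))

GLit : Set → Set → Set
GLit Pr Cn = Literal (Atom Pr Cn)

data TermHasVar {Cn : Set} (x : ℕ) : Term Cn → Set where
  here : TermHasVar x (var x)

data TermHasCon {Cn : Set} (c : Cn) : Term Cn → Set where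
  here : TermHasCon c (con c)

atomOf : {A : Set} → Literal A → A
atomOf (+ₗ a) = a
atomOf (-ₗ a) = a

LitHasVar : {Pr Cn : Set} → ℕ → NLit Pr Cn → Set
LitHasVar x l = ∃ λ t → t ∈ args (atomOf l) × TermHasVar x t

LitHasCon : {Pr Cn : Set} → Cn → NLit Pr Cn → Set
LitHasCon c l = ∃ λ t → t ∈ args (atomOf l) × TermHasCon c t

data InRule {L : Set} (l : L) (r : Rule L) : Set where
  inHead : l ∈ head r    → InRule l r
  inPos  : l ∈ bodyPos r → InRule l r
  inNeg  : l ∈ bodyNeg r → InRule l r

RuleHasVar : {Pr Cn : Set} → ℕ → Rule (NLit Pr Cn) → Set
RuleHasVar x r = ∃ λ l → InRule l r × LitHasVar x l

RuleHasCon : {Pr Cn : Set} → Cn → Rule (NLit Pr Cn) → Set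
RuleHasCon c r = ∃ λ l → InRule l r × LitHasCon c l

RulesHaveCon : {Pr Cn : Set} → Cn → List (Rule (NLit Pr Cn)) → Set
RulesHaveCon c Π = ∃ λ r → r ∈ Π × RuleHasCon c r

substT : {Cn : Set} → (ℕ → Cn) → Term Cn → Cn
substT σ (var x) = σ x
substT σ (con c) = c

mapL : {A B : Set} → (A → B) → List A → List B
mapL f []       = []
mapL f (x ∷ xs) = f x ∷ mapL f xs

substA : {Pr Cn : Set} → (ℕ → Cn) → Atom Pr (Term Cn) → Atom Pr Cn
substA σ (atom p ts) = atom p (mapL (substT σ) ts)

substL : {Pr Cn : Set} → (ℕ → Cn) → NLit Pr Cn → GLit Pr Cn
substL σ = mapLit (substA σ)

length-mapL : {A B : Set} (f : A → B) (xs : List A) → length (mapL f xs) ≡ length xs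
length-mapL f []       = Relation.Binary.PropositionalEquality.refl
length-mapL f (x ∷ xs) = Relation.Binary.PropositionalEquality.cong Data.Nat.suc (length-mapL f xs)
  where import Data.Nat

instRule : {Pr Cn : Set} → (ℕ → Cn) → Rule (NLit Pr Cn) → Rule (GLit Pr Cn)
instRule σ r = mkRule (mapL (substL σ) (head r))
  (Relation.Binary.PropositionalEquality.subst (1 ≤_)
     (Relation.Binary.PropositionalEquality.sym (length-mapL (substL σ) (head r))) (head-ne r))
  (mapL (substL σ) (bodyPos r)) (mapL (substL σ) (bodyNeg r)) (defeasible r)

LitSet : Set → Set → Set
LitSet Pr Cn = GLit Pr Cn → Bool

_∈ₛ_ : {Pr Cn : Set} → GLit Pr Cn → LitSet Pr Cn → Set
l ∈ₛ S = S l ≡ true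

_⊆ₛ_ : {Pr Cn : Set} → LitSet Pr Cn → LitSet Pr Cn → Set
S ⊆ₛ T = ∀ l → l ∈ₛ S → l ∈ₛ T

Consistent : {Pr Cn : Set} → LitSet Pr Cn → Set
Consistent S = ∀ l → l ∈ₛ S → ¬ (compl l ∈ₛ S)

record Object (Pr Cn : Set) : Set where
  constructor mkObject
  field
    oid   : ℕ
    sigma : List (Rule (NLit Pr Cn))
open Object public

record Program (Pr Cn : Set) : Set₁ where
  field
    objects : List (Object Pr Cn)
    _<ₒ_    : Object Pr Cn → Object Pr Cn → Set
    isSPO   : IsStrictPartialOrder _≡_ _<ₒ_
open Program public

ProgHasCon : {Pr Cn : Set} → Cn → Program Pr Cn → Set
ProgHasCon c P = ∃ λ o → o ∈ objects P × RulesHaveCon c (sigma o)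

-- ground(P): the (multiset of) ground instances, each tagged with its object
record GInst {Pr Cn : Set} (P : Program Pr Cn) : Set where
  field
    obj    : Object Pr Cn
    objIn  : obj ∈ objects P
    rule   : Rule (NLit Pr Cn)
    ruleIn : rule ∈ sigma obj
    σ      : ℕ → Cn
    σ-ok   : ∀ x → RuleHasVar x rule → ProgHasCon (σ x) P
open GInst public

gr : {Pr Cn : Set} {P : Program Pr Cn} → GInst P → Rule (GLit Pr Cn)
gr g = instRule (σ g) (rule g)

BodyTrue : {Pr Cn : Set} → LitSet Pr Cn → Rule (GLit Pr Cn) → Set
BodyTrue I r = (∀ l → l ∈ bodyPos r → l ∈ₛ I) × (∀ l → l ∈ bodyNeg r → ¬ (l ∈ₛ I))

HeadHit : {Pr Cn : Set} → LitSet Pr Cn → Rule (GLit Pr Cn) → Set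
HeadHit I r = ∃ λ l → l ∈ head r × l ∈ₛ I

Satisfied : {Pr Cn : Set} → LitSet Pr Cn → Rule (GLit Pr Cn) → Set
Satisfied I r = HeadHit I r ⊎ ¬ BodyTrue I r

module _ {Pr Cn : Set} (P : Program Pr Cn) where

  Threatens : GInst P → GInst P → GLit Pr Cn → Set
  Threatens g₁ g₂ l =
    compl l ∈ head (gr g₁) × l ∈ head (gr g₂) ×
    (_<ₒ_ P (obj g₁) (obj g₂)) × defeasible (gr g₂) ≡ true

  Overrides : LitSet Pr Cn → GInst P → GInst P → GLit Pr Cn → Set
  Overrides I g₁ g₂ l = Threatens g₁ g₂ l × compl l ∈ₛ I × BodyTrue I (gr g₂)

  Overridden : LitSet Pr Cn → GInst P → Set
  Overridden I g₂ = defeasible (gr g₂) ≡ true ×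
    (∀ l → l ∈ head (gr g₂) → ∃ λ g₁ → Overrides I g₁ g₂ l)

  IsModel : LitSet Pr Cn → Set
  IsModel I = Consistent I × (∀ g → Satisfied I (gr g) ⊎ Overridden I g)

  -- membership of (the reduced form of) g in G_I(P)
  InGI : LitSet Pr Cn → GInst P → Set
  InGI I g = ¬ Overridden I g × (∀ l → l ∈ bodyNeg (gr g) → ¬ (l ∈ₛ I))

  -- N is a model of pos(G_I(P)): ¬p treated as a new predicate, so no
  -- consistency requirement; the not-parts are deleted
  PosModelGI : LitSet Pr Cn → LitSet Pr Cn → Set
  PosModelGI I N = ∀ g → InGI I g →
    HeadHit N (gr g) ⊎ ¬ (∀ l → l ∈ bodyPos (gr g) → l ∈ₛ N)

  DLPAnswerSet : LitSet Pr Cn → Set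
  DLPAnswerSet M = IsModel M × PosModelGI M M ×
    (∀ N → PosModelGI M N → N ⊆ₛ M → M ⊆ₛ N)

module _ {Pr Cn : Set} (Π : List (Rule (NLit Pr Cn))) where

  record GLInst : Set where
    field
      rule   : Rule (NLit Pr Cn)
      ruleIn : rule ∈ Π
      σ      : ℕ → Cn
      σ-ok   : ∀ x → RuleHasVar x rule → RulesHaveCon (σ x) Π

  grGL : GLInst → Rule (GLit Pr Cn)
  grGL g = instRule (GLInst.σ g) (GLInst.rule g)

  InReduct : LitSet Pr Cn → GLInst → Set
  InReduct S g = ∀ l → l ∈ bodyNeg (grGL g) → ¬ (l ∈ₛ S)

  ClosedReduct : LitSet Pr Cn → LitSet Pr Cn → Set
  ClosedReduct S T =
    (∀ g → InReduct S g → (∀ l → l ∈ bodyPos (grGL g) → l ∈ₛ T) → HeadHit T (grGL g)) ×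
    ((∃ λ l → l ∈ₛ T × compl l ∈ₛ T) → ∀ l → l ∈ₛ T)

  GLAnswerSet : LitSet Pr Cn → Set
  GLAnswerSet S = ClosedReduct S S × (∀ T → ClosedReduct S T → T ⊆ₛ S → S ⊆ₛ T)

  ConsistentGLAnswerSet : LitSet Pr Cn → Set
  ConsistentGLAnswerSet S = GLAnswerSet S × Consistent S

{-# OPTIONS --safe #-}
-- With a single object no rule can be overridden, since overriding needs
-- obj g₁ < obj g₂ and < is irreflexive.  Hence G_M(P) is exactly the
-- Gelfond–Lifschitz reduct Σ(o)^M, "model of pos(G_M(P))" and "closed under
-- the rules of Σ(o)^M" coincide, and a model of the reduct whose body-true
-- rules have a true head is a model of Σ(o).  The only remaining difference,
-- clause (ii) of GL answer sets, is vacuous for consistent sets, and every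
-- candidate N ⊆ M in the minimality conditions is consistent because M is.
module Submission where

open import Defs
open import Data.Bool using (true) renaming (_≟_ to _≟ᵇ_)
open import Data.List using (List; _∷_; [])
open import Data.List.Membership.Propositional using (_∈_)
open import Data.List.Relation.Unary.All as All using (all?)
open import Data.List.Relation.Unary.Any using (here; there)
open import Data.Product using (_×_; _,_)
open import Data.Sum using (inj₁; [_,_]′; map₁)
open import Function using (id)
open import Relation.Nullary using (¬_; Dec; contradiction)
open import Relation.Nullary.Decidable using (map′; toSum; ¬?; _×-dec_)
open import Relation.Unary using (Decidable)
open import Relation.Binary.PropositionalEquality using (_≡_; refl; sym; trans; subst)
open import Relation.Binary.Structures using (IsStrictPartialOrder)

∀∈? : {A : Set} {P : A → Set} → Decidable P → (xs : List A) → Dec (∀ x → x ∈ xs → P x)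
∀∈? P? xs = map′ (λ all _ → All.lookup all) (λ f → All.tabulate (f _)) (all? P? xs)

module _ {Pr Cn : Set} where

  _∈ₛ?_ : (l : GLit Pr Cn) (S : LitSet Pr Cn) → Dec (l ∈ₛ S)
  l ∈ₛ? S = S l ≟ᵇ true

  bodyTrue? : (S : LitSet Pr Cn) (r : Rule (GLit Pr Cn)) → Dec (BodyTrue S r)
  bodyTrue? S r = ∀∈? (_∈ₛ? S) (bodyPos r) ×-dec ∀∈? (λ l → ¬? (l ∈ₛ? S)) (bodyNeg r)

  satisfied-if : (S : LitSet Pr Cn) (r : Rule (GLit Pr Cn)) →
                 (BodyTrue S r → HeadHit S r) → Satisfied S r
  satisfied-if S r body⇒head = map₁ body⇒head (toSum (bodyTrue? S r))

  Consistent-⊆ : {S T : LitSet Pr Cn} → T ⊆ₛ S → Consistent S → Consistent T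
  Consistent-⊆ T⊆S consS l l∈T l̅∈T = consS l (T⊆S l l∈T) (T⊆S _ l̅∈T)

  SatisfiesReduct : List (Rule (NLit Pr Cn)) → LitSet Pr Cn → LitSet Pr Cn → Set
  SatisfiesReduct Π S T = ∀ g → InReduct Π S g →
    (∀ l → l ∈ bodyPos (grGL Π g) → l ∈ₛ T) → HeadHit T (grGL Π g)

  consistent⇒closedReduct : {Π : List (Rule (NLit Pr Cn))} {S T : LitSet Pr Cn} →
                            SatisfiesReduct Π S T → Consistent T → ClosedReduct Π S T
  consistent⇒closedReduct satT consT = satT , λ { (l , l∈T , l̅∈T) → contradiction l̅∈T (consT l l∈T) }

module SingleObject {Pr Cn : Set} (P : Program Pr Cn) (o : Object Pr Cn)
                    (objects≡o : objects P ≡ o ∷ []) where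

  Π : List (Rule (NLit Pr Cn))
  Π = sigma o

  ∈objects⇒≡o : ∀ {o′} → o′ ∈ objects P → o′ ≡ o
  ∈objects⇒≡o o′∈ with subst (_ ∈_) objects≡o o′∈
  ... | here o′≡o = o′≡o

  o∈objects : o ∈ objects P
  o∈objects = subst (o ∈_) (sym objects≡o) (here refl)

  asGLInst : GInst P → GLInst Π
  asGLInst g = record
    { rule   = rule g
    ; ruleIn = subst (λ o′ → rule g ∈ sigma o′) (∈objects⇒≡o (objIn g)) (ruleIn g)
    ; σ      = σ g
    ; σ-ok   = λ x x∈r → onlyO (σ-ok g x x∈r)
    }
    where
    onlyO : ∀ {c} → ProgHasCon c P → RulesHaveCon c Π
    onlyO (o′ , o′∈ , c∈o′) = subst (λ o″ → RulesHaveCon _ (sigma o″)) (∈objects⇒≡o o′∈) c∈o′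

  asGInst : GLInst Π → GInst P
  asGInst g = record
    { obj    = o
    ; objIn  = o∈objects
    ; rule   = GLInst.rule g
    ; ruleIn = GLInst.ruleIn g
    ; σ      = GLInst.σ g
    ; σ-ok   = λ x x∈r → o , o∈objects , GLInst.σ-ok g x x∈r
    }

  ¬overridden : ∀ I g → ¬ Overridden P I g
  ¬overridden I g (_ , overridesAll) with head (gr g) | head-ne (gr g) | overridesAll
  ... | l ∷ _ | _ | overridesAll with overridesAll l (here refl)
  ...   | g₁ , (_ , _ , g₁<g , _) , _ =
    IsStrictPartialOrder.irrefl (isSPO P) (trans (∈objects⇒≡o (objIn g₁)) (sym (∈objects⇒≡o (objIn g)))) g₁<g

  posModel⇒satisfiesReduct : ∀ {M N} → PosModelGI P M N → SatisfiesReduct Π M N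
  posModel⇒satisfiesReduct {M} posN g inReduct body⊆N =
    [ id , contradiction body⊆N ]′ (posN (asGInst g) (¬overridden M (asGInst g) , inReduct))

  satisfiesReduct⇒posModel : ∀ {M N} → SatisfiesReduct Π M N → PosModelGI P M N
  satisfiesReduct⇒posModel {N = N} satN g (_ , inReduct) =
    map₁ (satN (asGLInst g) inReduct) (toSum (∀∈? (_∈ₛ? N) (bodyPos (gr g))))

  satisfiesReduct⇒satisfied : ∀ {M} → SatisfiesReduct Π M M → ∀ g → Satisfied M (gr g)
  satisfiesReduct⇒satisfied {M} satM g =
    satisfied-if M (gr g) (λ { (body⊆M , bodyNeg∩M≡∅) → satM (asGLInst g) bodyNeg∩M≡∅ body⊆M })

  dlp⇒gl : ∀ M → DLPAnswerSet P M → ConsistentGLAnswerSet Π M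
  dlp⇒gl M ((consM , _) , posM , minM) =
    ( consistent⇒closedReduct (posModel⇒satisfiesReduct posM) consM
    , λ T (satT , _) T⊆M → minM T (satisfiesReduct⇒posModel satT) T⊆M )
    , consM

  gl⇒dlp : ∀ M → ConsistentGLAnswerSet Π M → DLPAnswerSet P M
  gl⇒dlp M (((satM , _) , minM) , consM) =
    (consM , λ g → inj₁ (satisfiesReduct⇒satisfied satM g))
    , satisfiesReduct⇒posModel satM
    , λ N posN N⊆M → minM N
        (consistent⇒closedReduct (posModel⇒satisfiesReduct posN) (Consistent-⊆ N⊆M consM)) N⊆M

theorem3 : {Pr Cn : Set} (P : Program Pr Cn) (o : Object Pr Cn) →
    objects P ≡ o ∷ [] → (M : LitSet Pr Cn) →
    (DLPAnswerSet P M → ConsistentGLAnswerSet (sigma o) M) ×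
    (ConsistentGLAnswerSet (sigma o) M → DLPAnswerSet P M)
theorem3 P o objects≡o M = dlp⇒gl M , gl⇒dlp M
  where open SingleObject P o objects≡o
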